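{- Let $\mathbf{A}$ be an algebra in a variety $\mathcal{V}$ with a weak difference term, $\theta$ an abelian congruence of $\mathbf{A}$, $\alpha=(0:\theta)$, $\Delta=\Delta_{\theta,\alpha}$, and $\varphi=\overline{\alpha}/\Delta$. For $e\in A$ let $\lambda_e:e/\theta\to D(\mathbf{A},\theta)$ be given by $\lambda_e(x)=(x,e)/\Delta$. (1) For all $e\in A$, $\lambda_e$ is an embedding of the group $\mathbb{A}(\theta,e)$ into the group $\mathbb{D}(\varphi,0_{e/\alpha})$, where $\mathbf{D}=D(\mathbf{A},\theta)$. (2) If $\mathcal{V}$ has a difference term, then $\lambda_e$ is an isomorphism.
   Context: $C(\varphi,\theta;\delta)$ means: for every term $t(\bar x,\bar y)$, all $(a_i,b_i)\in\varphi$, $(c_j,d_j)\in\theta$, if $t(\bar a,\bar c)\equiv_\delta t(\bar a,\bar d)$ then $t(\bar b,\bar c)\equiv_\delta t(\bar b,\bar d)$. $(\delta:\theta)$ is the largest $\varphi$ with $C(\varphi,\theta;\delta)$; $\theta/\delta$ abelian iff $C(\theta,\theta;\delta)$; $\theta$ abelian iff $C(\theta,\theta;0)$. A weak difference term for an algebra is an idempotent ternary term $d$ with $d(a,a,b)\equiv_\delta b\equiv_\delta d(b,a,a)$ for all $(a,b)\in\theta$ whenever $\delta\le\theta$ are congruences with $\theta/\delta$ abelian; for $\mathcal{V}$ it must be one for every member. A difference term is a weak difference term for $\mathcal{V}$ additionally satisfying the identity $d(x,x,y)\approx y$. If an algebra $\mathbf{B}$ has a weak difference term $d$, $\kappa$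 is an abelian congruence of $\mathbf{B}$ and $e\in B$, then $\mathbb{B}(\kappa,e)$ denotes the abelian group with universe $e/\kappa$, zero $e$ and operation $x+y=d(x,e,y)$ (independent of the choice of $d$). $\mathbf{A}(\theta)$ is $\theta$ as a subalgebra of $\mathbf{A}^2$; $\Delta_{\theta,\alpha}$ is the congruence of $\mathbf{A}(\theta)$ generated by $\{((a,a),(b,b)):(a,b)\in\alpha\}$; $\overline{\alpha}=\{((a_1,a_2),(b_1,b_2))\in A(\theta)^2:(a_1,b_1)\in\alpha\}$; $D(\mathbf{A},\theta)=\mathbf{A}(\theta)/\Delta$. For an $\alpha$-class $E$, $0_E=\{(c,c):c\in E\}\in D(\mathbf{A},\theta)$. (Here $\varphi$ is an abelian congruence of $D(\mathbf{A},\theta)\in\mathcal{V}$.) -}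

module Defs where

open import Level using (Level) renaming (suc to lsuc)
open import Data.Nat using (ℕ)
open import Data.Fin using (Fin; zero; suc)
open import Data.Sum using (_⊎_; [_,_])
open import Data.Product using (Σ; Σ-syntax; _×_; _,_; proj₁; proj₂)
open import Relation.Binary using (Rel; IsEquivalence)

-- Signatures, terms, algebras (setoid-based, so quotients are algebras)

record Signature : Set₁ where
  field
    Op    : Set
    arity : Op → ℕ
open Signature public

data Term (S : Signature) (X : Set) : Set where
  var : X → Term S X
  op  : (f : Op S) → (Fin (arity S f) → Term S X) → Term S X

record Algebra (S : Signature) (ℓ : Level) : Set (lsuc ℓ) where
  field
    Carrier : Set ℓ
    _≈_     : Rel Carrier ℓ
    ≈-equiv : IsEquivalence _≈_
    ⟦_⟧     : (f : Op S) → (Fin (arity S f) → Carrier) → Carrier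
    ⟦⟧-cong : ∀ f {xs ys} → (∀ i → xs i ≈ ys i) → ⟦ f ⟧ xs ≈ ⟦ f ⟧ ys

Car : ∀ {S ℓ} → Algebra S ℓ → Set ℓ
Car = Algebra.Carrier

-- the equality (zero congruence) of an algebra
Eq : ∀ {S ℓ} (A : Algebra S ℓ) → Rel (Car A) ℓ
Eq = Algebra._≈_

module _ {S : Signature} {ℓ : Level} (A : Algebra S ℓ) where
  open Algebra A

  eval : {X : Set} → (X → Carrier) → Term S X → Carrier
  eval ρ (var x)   = ρ x
  eval ρ (op f ts) = ⟦ f ⟧ (λ i → eval ρ (ts i))

  _⊨_ : Σ ℕ (λ n → Term S (Fin n) × Term S (Fin n)) → Set ℓ
  _⊨_ (n , s , t) = (ρ : Fin n → Carrier) → eval ρ s ≈ eval ρ t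

  record IsCongruence (R : Rel Carrier ℓ) : Set ℓ where
    field
      ≈⊆R    : ∀ {x y} → x ≈ y → R x y
      equiv  : IsEquivalence R
      compat : ∀ f {xs ys} → (∀ i → R (xs i) (ys i)) → R (⟦ f ⟧ xs) (⟦ f ⟧ ys)

  TC : Rel Carrier ℓ → Rel Carrier ℓ → Rel Carrier ℓ → Set ℓ
  TC φ θ δ = ∀ {m n} (t : Term S (Fin m ⊎ Fin n))
               (a b : Fin m → Carrier) (c d : Fin n → Carrier) →
               (∀ i → φ (a i) (b i)) → (∀ j → θ (c j) (d j)) →
               δ (eval [ a , c ] t) (eval [ a , d ] t) →
               δ (eval [ b , c ] t) (eval [ b , d ] t)

  IsAnnihilator : Rel Carrier ℓ → Rel Carrier ℓ → Set (lsuc ℓ)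
  IsAnnihilator θ α =
    IsCongruence α × TC α θ _≈_ ×
    (∀ (R : Rel Carrier ℓ) → IsCongruence R → TC R θ _≈_ → ∀ x y → R x y → α x y)

  env3 : Carrier → Carrier → Carrier → Fin 3 → Carrier
  env3 a b c zero             = a
  env3 a b c (suc zero)       = b
  env3 a b c (suc (suc zero)) = c

  app3 : Term S (Fin 3) → Carrier → Carrier → Carrier → Carrier
  app3 d a b c = eval (env3 a b c) d

  IsWeakDiffTermFor : Term S (Fin 3) → Set (lsuc ℓ)
  IsWeakDiffTermFor d =
    (∀ x → app3 d x x x ≈ x) ×
    (∀ (δ θ : Rel Carrier ℓ) → IsCongruence δ → IsCongruence θ →
       (∀ x y → δ x y → θ x y) → TC θ θ δ →
       ∀ a b → θ a b → δ (app3 d a a b) b × δ (app3 d b a a) b)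

Equation : Signature → Set
Equation S = Σ ℕ (λ n → Term S (Fin n) × Term S (Fin n))

-- membership in the variety axiomatised by the set of identities E
Mod : ∀ {S ℓ} → (Equation S → Set) → Algebra S ℓ → Set ℓ
Mod E A = ∀ e → E e → A ⊨ e

-- weak difference term / difference term for the variety Mod E
-- (quantifying over all members whose carrier and equality live at level ℓ)
IsWeakDiffTermOf : ∀ {S} → (Equation S → Set) → (ℓ : Level) → Term S (Fin 3) → Set (lsuc ℓ)
IsWeakDiffTermOf {S} E ℓ d = (B : Algebra S ℓ) → Mod E B → IsWeakDiffTermFor B d

IsDiffTermOf : ∀ {S} → (Equation S → Set) → (ℓ : Level) → Term S (Fin 3) → Set (lsuc ℓ)
IsDiffTermOf {S} E ℓ d =
  IsWeakDiffTermOf E ℓ d ×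
  ((B : Algebra S ℓ) → Mod E B → ∀ x y → Eq B (app3 B d x x y) y)

module _ {S : Signature} {ℓ : Level} (A : Algebra S ℓ)
         (θ : Rel (Car A) ℓ) (θc : IsCongruence A θ) where
  open Algebra A
  private
    module θC = IsCongruence θc
    module ≈E = IsEquivalence ≈-equiv

  Aθ : Algebra S ℓ
  Aθ = record
    { Carrier = Σ (Carrier × Carrier) (λ p → θ (proj₁ p) (proj₂ p))
    ; _≈_ = λ u v → (proj₁ (proj₁ u) ≈ proj₁ (proj₁ v)) × (proj₂ (proj₁ u) ≈ proj₂ (proj₁ v))
    ; ≈-equiv = record
        { refl  = ≈E.refl , ≈E.refl
        ; sym   = λ p → ≈E.sym (proj₁ p) , ≈E.sym (proj₂ p)
        ; trans = λ p q → ≈E.trans (proj₁ p) (proj₁ q) , ≈E.trans (proj₂ p) (proj₂ q) }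
    ; ⟦_⟧ = λ f us → ((⟦ f ⟧ (λ i → proj₁ (proj₁ (us i)))) , ⟦ f ⟧ (λ i → proj₂ (proj₁ (us i))))
                     , θC.compat f (λ i → proj₂ (us i))
    ; ⟦⟧-cong = λ f ps → ⟦⟧-cong f (λ i → proj₁ (ps i)) , ⟦⟧-cong f (λ i → proj₂ (ps i))
    }

  diag : Carrier → Car Aθ
  diag a = (a , a) , IsEquivalence.refl θC.equiv

  IsDelta : Rel Carrier ℓ → Rel (Car Aθ) ℓ → Set (lsuc ℓ)
  IsDelta α Δ =
    IsCongruence Aθ Δ ×
    (∀ a b → α a b → Δ (diag a) (diag b)) ×
    (∀ (R : Rel (Car Aθ) ℓ) → IsCongruence Aθ R →
       (∀ a b → α a b → R (diag a) (diag b)) → ∀ u v → Δ u v → R u v)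

  -- ᾱ on A(θ) (hence on D(A,θ), whose elements are represented by those of A(θ))
  overline : Rel Carrier ℓ → Rel (Car Aθ) ℓ
  overline α u v = α (proj₁ (proj₁ u)) (proj₁ (proj₁ v))

  -- λ_e(x) = (x, e)  (the Δ-class of it, as an element of D(A,θ))
  lam : (e x : Carrier) → θ x e → Car Aθ
  lam e x p = (x , e) , p

  zeroE : Carrier → Car Aθ
  zeroE e = diag e

Quot : ∀ {S ℓ} (B : Algebra S ℓ) (R : Rel (Car B) ℓ) → IsCongruence B R → Algebra S ℓ
Quot B R Rc = record
  { Carrier = Car B
  ; _≈_ = R
  ; ≈-equiv = IsCongruence.equiv Rc
  ; ⟦_⟧ = Algebra.⟦_⟧ B
  ; ⟦⟧-cong = IsCongruence.compat Rc
  }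

{-# OPTIONS --safe #-}

-- λ_e respects d because d is idempotent, and with a difference term it is onto the
-- φ-class of 0: since e α b, (a , b) ≈ d((a,b),(b,b),(b,b)) Δ d((a,b),(b,b),(e,e)) ≈ λ_e(d(a,b,e)).
-- Injectivity rests on C(α, θ; 0), which says precisely that the generators of Δ lie in the
-- syntactic congruence of the diagonal of A(θ); hence the diagonal is a union of Δ-classes.
-- As d is a Mal'cev operation on the abelian congruence θ, the polynomial
-- u ↦ d(u, (e,e), (e,y)) sends (x , e) to (x , y) and (y , e) to (y , y), so (x , e) Δ (y , e)
-- forces (x , y) onto the diagonal.
module Submission where

open import Defs
open import Level using (Level)
open import Data.Fin using (Fin; zero; suc; _↑ˡ_; _↑ʳ_)
open import Data.Nat as ℕ using (ℕ; _+_)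
open import Data.Product using (Σ; Σ-syntax; _×_; _,_; proj₁; proj₂)
open import Data.Sum using (_⊎_; inj₁; inj₂; [_,_]; map₂)
open import Data.Vec.Functional using (Vector; _∷_; _++_; tail)
open import Data.Vec.Functional.Properties using (lookup-++ˡ; lookup-++ʳ)
open import Function using (_∘_; id; const; _⇔_; mk⇔; Equivalence)
open import Function.Properties.Equivalence using (⇔-isEquivalence)
open import Relation.Binary using (Rel; Setoid; IsEquivalence; Symmetric)
import Relation.Binary.Reasoning.Setoid as SetoidReasoning

setoid : ∀ {S ℓ} → Algebra S ℓ → Setoid ℓ ℓ
setoid A = record { isEquivalence = Algebra.≈-equiv A }

sub : ∀ {S X Y} → (X → Term S Y) → Term S X → Term S Y
sub σ (var x)   = σ x
sub σ (op f ts) = op f (λ i → sub σ (ts i))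

rename : ∀ {S X Y} → (X → Y) → Term S X → Term S Y
rename f = sub (var ∘ f)

module _ {S : Signature} {ℓ : Level} (C : Algebra S ℓ) where
  open Algebra C
  open IsEquivalence ≈-equiv

  ≈-isCongruence : IsCongruence C _≈_
  ≈-isCongruence = record { ≈⊆R = id ; equiv = ≈-equiv ; compat = ⟦⟧-cong }

  eval-preserves : ∀ {R} → IsCongruence C R → ∀ {X} {ρ ρ′ : X → Carrier} →
                   (∀ x → R (ρ x) (ρ′ x)) → ∀ t → R (eval C ρ t) (eval C ρ′ t)
  eval-preserves Rc ρRρ′ (var x)   = ρRρ′ x
  eval-preserves Rc ρRρ′ (op f ts) = IsCongruence.compat Rc f (λ i → eval-preserves Rc ρRρ′ (ts i))

  eval-cong : ∀ {X} {ρ ρ′ : X → Carrier} → (∀ x → ρ x ≈ ρ′ x) → ∀ t → eval C ρ t ≈ eval C ρ′ t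
  eval-cong = eval-preserves ≈-isCongruence

  app3-preserves : ∀ {R} → IsCongruence C R → ∀ d {a a′ b b′ c c′} →
                   R a a′ → R b b′ → R c c′ → R (app3 C d a b c) (app3 C d a′ b′ c′)
  app3-preserves Rc d aRa′ bRb′ cRc′ =
    eval-preserves Rc (λ { zero → aRa′ ; (suc zero) → bRb′ ; (suc (suc zero)) → cRc′ }) d

  eval-sub : ∀ {X Y} {σ : X → Term S Y} {ρ : Y → Carrier} {ρ′ : X → Carrier} →
             (∀ x → eval C ρ (σ x) ≈ ρ′ x) → ∀ t → eval C ρ (sub σ t) ≈ eval C ρ′ t
  eval-sub σ≈ρ′ (var x)   = σ≈ρ′ x
  eval-sub σ≈ρ′ (op f ts) = ⟦⟧-cong f (λ i → eval-sub σ≈ρ′ (ts i))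

IsHom : ∀ {S ℓ} (B A : Algebra S ℓ) → (Car B → Car A) → Set ℓ
IsHom B A h = ∀ f xs → Eq A (h (Algebra.⟦_⟧ B f xs)) (Algebra.⟦_⟧ A f (h ∘ xs))

module _ {S : Signature} {ℓ : Level} (B A : Algebra S ℓ) (h : Car B → Car A) (h-hom : IsHom B A h) where
  open Algebra A
  open IsEquivalence ≈-equiv

  eval-hom : ∀ {X} {ρ : X → Car B} {ρ′ : X → Carrier} →
             (∀ x → h (ρ x) ≈ ρ′ x) → ∀ t → h (eval B ρ t) ≈ eval A ρ′ t
  eval-hom hρ≈ρ′ (var x)   = hρ≈ρ′ x
  eval-hom hρ≈ρ′ (op f ts) = trans (h-hom f _) (⟦⟧-cong f (λ i → eval-hom hρ≈ρ′ (ts i)))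

  app3-hom : ∀ d a b c → h (app3 B d a b c) ≈ app3 A d (h a) (h b) (h c)
  app3-hom d a b c = eval-hom (λ { zero → refl ; (suc zero) → refl ; (suc (suc zero)) → refl }) d

Poly : Signature → ℕ → Set
Poly S n = Term S (Fin 1 ⊎ Fin n)

plug : ∀ {S n n′} → Poly S n → Fin 1 ⊎ Fin n′ → Poly S (n + n′)
plug {n = n} {n′} t = [ const (rename (map₂ (_↑ˡ n′)) t) , (λ j → var (inj₂ (n ↑ʳ j))) ]

_⊚_ : ∀ {S n n′} → Poly S n′ → Poly S n → Poly S (n + n′)
t′ ⊚ t = sub (plug t) t′

module _ {S : Signature} {ℓ : Level} (C : Algebra S ℓ) where
  open Algebra C
  open IsEquivalence ≈-equiv

  poly : ∀ {n} → Poly S n → Vector Carrier n → Carrier → Carrier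
  poly t w x = eval C [ const x , w ] t

  poly-⊚ : ∀ {n n′} (t′ : Poly S n′) (t : Poly S n) w w′ x →
           poly (t′ ⊚ t) (w ++ w′) x ≈ poly t′ w′ (poly t w x)
  poly-⊚ t′ t w w′ x = eval-sub C inner-or-parameter t′
    where
    inner-or-parameter : ∀ v → eval C [ const x , w ++ w′ ] (plug t v) ≈ [ const (poly t w x) , w′ ] v
    inner-or-parameter (inj₁ _) =
      eval-sub C (λ { (inj₁ _) → refl ; (inj₂ j) → reflexive (lookup-++ˡ w w′ j) }) t
    inner-or-parameter (inj₂ j) = reflexive (lookup-++ʳ w w′ j)

  ClosedUnderPolys : Rel Carrier ℓ → Set ℓ
  ClosedUnderPolys R = ∀ {n} (t : Poly S n) w {x y} → R x y → R (poly t w x) (poly t w y)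

  polyClosed⇒isCongruence : ∀ {R} → (∀ {x y} → x ≈ y → R x y) → IsEquivalence R →
                            ClosedUnderPolys R → IsCongruence C R
  polyClosed⇒isCongruence {R} ≈⇒R R-equiv closed = record
    { ≈⊆R = ≈⇒R
    ; equiv = R-equiv
    ; compat = λ f → eval-preserves-polyClosed _ {0} (op f (var ∘ inj₁)) (λ ())
    }
    where
    R-setoid : Setoid ℓ ℓ
    R-setoid = record { isEquivalence = R-equiv }
    open SetoidReasoning R-setoid

    eval-preserves-polyClosed : ∀ m {n} (t : Term S (Fin m ⊎ Fin n)) (w : Vector Carrier n) {xs ys} →
                                (∀ i → R (xs i) (ys i)) → R (eval C [ xs , w ] t) (eval C [ ys , w ] t)
    eval-preserves-polyClosed 0 t w _ = ≈⇒R (eval-cong C (λ { (inj₂ _) → refl }) t)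
    eval-preserves-polyClosed (ℕ.suc m) {n} t w {xs} {ys} xsRys = begin
      eval C [ xs , w ] t                     ≈⟨ ≈⇒R (sym (head-as-hole xs)) ⟩
      poly t₁ (tail xs ++ w) (xs zero)         ≈⟨ closed t₁ (tail xs ++ w) (xsRys zero) ⟩
      poly t₁ (tail xs ++ w) (ys zero)         ≈⟨ ≈⇒R (head-as-hole (ys zero ∷ tail xs)) ⟩
      eval C [ ys zero ∷ tail xs , w ] t       ≈⟨ ≈⇒R (sym (head-as-parameter (ys zero ∷ tail xs))) ⟩
      eval C [ tail xs , ys zero ∷ w ] t₂      ≈⟨ eval-preserves-polyClosed m t₂ (ys zero ∷ w) (xsRys ∘ suc) ⟩
      eval C [ tail ys , ys zero ∷ w ] t₂      ≈⟨ ≈⇒R (head-as-parameter ys) ⟩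
      eval C [ ys , w ] t                     ∎
      where
      t₁ : Poly S (m + n)
      t₁ = rename [ (λ { zero → inj₁ zero ; (suc i) → inj₂ (i ↑ˡ n) }) , (λ j → inj₂ (m ↑ʳ j)) ] t

      t₂ : Term S (Fin m ⊎ Fin (ℕ.suc n))
      t₂ = rename [ (λ { zero → inj₂ zero ; (suc i) → inj₁ i }) , inj₂ ∘ suc ] t

      head-as-hole : ∀ zs → poly t₁ (tail zs ++ w) (zs zero) ≈ eval C [ zs , w ] t
      head-as-hole zs = eval-sub C
        (λ { (inj₁ zero)    → refl
           ; (inj₁ (suc i)) → reflexive (lookup-++ˡ (tail zs) w i)
           ; (inj₂ j)       → reflexive (lookup-++ʳ (tail zs) w j) }) t

      head-as-parameter : ∀ zs → eval C [ tail zs , zs zero ∷ w ] t₂ ≈ eval C [ zs , w ] t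
      head-as-parameter zs = eval-sub C
        (λ { (inj₁ zero) → refl ; (inj₁ (suc i)) → refl ; (inj₂ j) → refl }) t

  Syntactic : (Carrier → Set ℓ) → Rel Carrier ℓ
  Syntactic P x y = ∀ n (t : Poly S n) w → P (poly t w x) ⇔ P (poly t w y)

  syntactic-saturates : ∀ P {x y} → Syntactic P x y → P x → P y
  syntactic-saturates P x∼y = Equivalence.to (x∼y 0 (var (inj₁ zero)) (λ ()))

  syntactic-isCongruence : ∀ P → (∀ {x y} → x ≈ y → P x → P y) → IsCongruence C (Syntactic P)
  syntactic-isCongruence P P-resp = polyClosed⇒isCongruence ≈⇒∼ ∼-isEquivalence ∼-closed
    where
    module ⇔ = IsEquivalence (⇔-isEquivalence {ℓ})

    P-resp⇔ : ∀ {x y} → x ≈ y → P x ⇔ P y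
    P-resp⇔ x≈y = mk⇔ (P-resp x≈y) (P-resp (sym x≈y))

    ≈⇒∼ : ∀ {x y} → x ≈ y → Syntactic P x y
    ≈⇒∼ x≈y n t w = P-resp⇔ (eval-cong C (λ { (inj₁ _) → x≈y ; (inj₂ _) → refl }) t)

    ∼-isEquivalence : IsEquivalence (Syntactic P)
    ∼-isEquivalence = record
      { refl  = λ n t w → ⇔.refl
      ; sym   = λ x∼y n t w → ⇔.sym (x∼y n t w)
      ; trans = λ x∼y y∼z n t w → ⇔.trans (x∼y n t w) (y∼z n t w)
      }

    ∼-closed : ClosedUnderPolys (Syntactic P)
    ∼-closed t w {x} {y} x∼y n′ t′ w′ =
      ⇔.trans (P-resp⇔ (sym (poly-⊚ t′ t w w′ x)))
        (⇔.trans (x∼y _ (t′ ⊚ t) (w ++ w′)) (P-resp⇔ (poly-⊚ t′ t w w′ y)))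

IsMaltsevOn : ∀ {S ℓ} (A : Algebra S ℓ) → Term S (Fin 3) → Rel (Car A) ℓ → Set ℓ
IsMaltsevOn A d θ = ∀ a b → θ a b → Eq A (app3 A d a a b) b × Eq A (app3 A d b a a) b

weakDiffTerm-maltsevOnAbelian : ∀ {S ℓ} (A : Algebra S ℓ) d {θ} → IsWeakDiffTermFor A d →
                                IsCongruence A θ → TC A θ θ (Eq A) → IsMaltsevOn A d θ
weakDiffTerm-maltsevOnAbelian A d (_ , d-weak) θc θ-abelian =
  d-weak (Eq A) _ (≈-isCongruence A) θc (λ _ _ → IsCongruence.≈⊆R θc) θ-abelian

module _ {S : Signature} {ℓ : Level} (A : Algebra S ℓ) (θ : Rel (Car A) ℓ) (θc : IsCongruence A θ) where
  open Algebra A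
  open IsEquivalence ≈-equiv
  open SetoidReasoning (setoid A)
  private
    B = Aθ A θ θc
    module θ = IsEquivalence (IsCongruence.equiv θc)

  π₁ π₂ : Car B → Carrier
  π₁ ((a , _) , _) = a
  π₂ ((_ , b) , _) = b

  π₁-hom : IsHom B A π₁
  π₁-hom _ _ = refl

  π₂-hom : IsHom B A π₂
  π₂-hom _ _ = refl

  π₁-app3 : ∀ d u v w → π₁ (app3 B d u v w) ≈ app3 A d (π₁ u) (π₁ v) (π₁ w)
  π₁-app3 = app3-hom B A π₁ π₁-hom

  π₂-app3 : ∀ d u v w → π₂ (app3 B d u v w) ≈ app3 A d (π₂ u) (π₂ v) (π₂ w)
  π₂-app3 = app3-hom B A π₂ π₂-hom

  IsDiagonal : Car B → Set ℓ
  IsDiagonal u = π₁ u ≈ π₂ u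

  isDiagonal-resp : ∀ {u v} → Eq B u v → IsDiagonal u → IsDiagonal v
  isDiagonal-resp (u₁≈v₁ , u₂≈v₂) u₁≈u₂ = trans (sym u₁≈v₁) (trans u₁≈u₂ u₂≈v₂)

  diag-syntactic : ∀ {α} → Symmetric α → TC A α θ (Eq A) → ∀ {s s′} → α s s′ →
                   Syntactic B IsDiagonal (diag A θ θc s) (diag A θ θc s′)
  diag-syntactic {α} α-sym α-centralizes sαs′ n t w = mk⇔ (transfer sαs′) (transfer (α-sym sαs′))
    where
    transfer : ∀ {a b} → α a b → IsDiagonal (poly B t w (diag A θ θc a)) → IsDiagonal (poly B t w (diag A θ θc b))
    transfer {a} {b} aαb a-diagonal = begin
      π₁ (poly B t w (diag A θ θc b)) ≈⟨ π₁-poly b ⟩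
      eval A [ const b , π₁ ∘ w ] t   ≈⟨ α-centralizes t (const a) (const b) (π₁ ∘ w) (π₂ ∘ w)
                                           (const aαb) (proj₂ ∘ w) a-components-agree ⟩
      eval A [ const b , π₂ ∘ w ] t   ≈⟨ sym (π₂-poly b) ⟩
      π₂ (poly B t w (diag A θ θc b)) ∎
      where
      π₁-poly : ∀ c → π₁ (poly B t w (diag A θ θc c)) ≈ eval A [ const c , π₁ ∘ w ] t
      π₁-poly c = eval-hom B A π₁ π₁-hom (λ { (inj₁ _) → refl ; (inj₂ _) → refl }) t

      π₂-poly : ∀ c → π₂ (poly B t w (diag A θ θc c)) ≈ eval A [ const c , π₂ ∘ w ] t
      π₂-poly c = eval-hom B A π₂ π₂-hom (λ { (inj₁ _) → refl ; (inj₂ _) → refl }) t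

      a-components-agree : eval A [ const a , π₁ ∘ w ] t ≈ eval A [ const a , π₂ ∘ w ] t
      a-components-agree = trans (sym (π₁-poly a)) (trans a-diagonal (π₂-poly a))

  Δ-saturates-diagonal : ∀ {α Δ} → Symmetric α → TC A α θ (Eq A) → IsDelta A θ θc α Δ →
                         ∀ {u v} → Δ u v → IsDiagonal u → IsDiagonal v
  Δ-saturates-diagonal {α} α-sym α-centralizes (_ , _ , Δ-least) {u} {v} uΔv =
    syntactic-saturates B IsDiagonal (Δ-least (Syntactic B IsDiagonal) syntactic-diagonal-isCongruence
                                              (λ s s′ → diag-syntactic {α} α-sym α-centralizes {s} {s′})
                                              u v uΔv)
    where
    syntactic-diagonal-isCongruence : IsCongruence B (Syntactic B IsDiagonal)
    syntactic-diagonal-isCongruence = syntactic-isCongruence B IsDiagonal (λ {u} {v} → isDiagonal-resp {u} {v})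

  lam-hom : ∀ {Δ} (Δc : IsCongruence B Δ) d → (∀ x → app3 A d x x x ≈ x) →
            ∀ {e x y} (p : θ x e) (q : θ y e) (r : θ (app3 A d x e y) e) →
            Δ (lam A θ θc e (app3 A d x e y) r)
              (app3 (Quot B Δ Δc) d (lam A θ θc e x p) (zeroE A θ θc e) (lam A θ θc e y q))
  lam-hom {Δ} Δc d d-idem {e} p q r = IsCongruence.≈⊆R Δc
    ( sym (app3-hom D A π₁ π₁-hom d _ _ _)
    , trans (sym (d-idem e)) (sym (app3-hom D A π₂ π₂-hom d _ _ _)) )
    where
    D = Quot B Δ Δc

  lam-injective : ∀ {α Δ} d → Symmetric α → TC A α θ (Eq A) → IsDelta A θ θc α Δ → IsMaltsevOn A d θ →
                  ∀ {e x y} (p : θ x e) (q : θ y e) → Δ (lam A θ θc e x p) (lam A θ θc e y q) → x ≈ y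
  lam-injective {Δ = Δ} d α-sym α-centralizes isΔ@(Δc , _) maltsev {e} {x} {y} p q xΔy = begin
    x                                  ≈⟨ π₁-pair-with-y p ⟨
    π₁ (pair-with-y (lam A θ θc e x p)) ≈⟨ Δ-saturates-diagonal α-sym α-centralizes isΔ
                                            (Δ≈.sym (app3-preserves B Δc d xΔy Δ≈.refl Δ≈.refl))
                                            (trans (π₁-pair-with-y q) (sym (π₂-pair-with-y q))) ⟩
    π₂ (pair-with-y (lam A θ θc e x p)) ≈⟨ π₂-pair-with-y p ⟩
    y                                  ∎
    where
    module Δ≈ = IsEquivalence (IsCongruence.equiv Δc)

    pair-with-y : Car B → Car B
    pair-with-y u = app3 B d u (diag A θ θc e) ((e , y) , θ.sym q)

    π₁-pair-with-y : ∀ {z} (r : θ z e) → π₁ (pair-with-y (lam A θ θc e z r)) ≈ z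
    π₁-pair-with-y {z} r = trans (π₁-app3 d _ _ _) (proj₂ (maltsev e z (θ.sym r)))

    π₂-pair-with-y : ∀ {z} (r : θ z e) → π₂ (pair-with-y (lam A θ θc e z r)) ≈ y
    π₂-pair-with-y r = trans (π₂-app3 d _ _ _) (proj₁ (maltsev e y (θ.sym q)))

  lam-surjective : ∀ {α Δ} d → IsEquivalence α → (∀ {a b} → θ a b → α a b) → IsDelta A θ θc α Δ →
                   IsMaltsevOn A d θ → (∀ x y → app3 A d x x y ≈ y) →
                   ∀ e u → overline A θ θc α u (zeroE A θ θc e) →
                   Σ[ x ∈ Carrier ] Σ[ p ∈ θ x e ] Δ (lam A θ θc e x p) u
  lam-surjective {Δ = Δ} d α-equiv θ⊆α (Δc , Δ-generators , _) maltsev d-left e u@((a , b) , aθb) aαe =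
    app3 A d a b e , d[a,b,e]θe , λx-Δ-u
    where
    module α = IsEquivalence α-equiv
    module Δ≈ = IsEquivalence (IsCongruence.equiv Δc)
    module Δ = SetoidReasoning (setoid (Quot B Δ Δc))

    d[a,b,e]θe : θ (app3 A d a b e) e
    d[a,b,e]θe = θ.trans (app3-preserves A θc d θ.refl (θ.sym aθb) θ.refl) (IsCongruence.≈⊆R θc (d-left a e))

    λx-Δ-u : Δ (lam A θ θc e (app3 A d a b e) d[a,b,e]θe) u
    λx-Δ-u = Δ.begin
      lam A θ θc e (app3 A d a b e) d[a,b,e]θe
        Δ.≈⟨ IsCongruence.≈⊆R Δc (sym (π₁-app3 d _ _ _) , trans (sym (d-left b e)) (sym (π₂-app3 d _ _ _))) ⟩
      app3 B d u (diag A θ θc b) (diag A θ θc e)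
        Δ.≈⟨ app3-preserves B Δc d Δ≈.refl Δ≈.refl (Δ-generators b e (α.trans (α.sym (θ⊆α aθb)) aαe)) ⟨
      app3 B d u (diag A θ θc b) (diag A θ θc b)
        Δ.≈⟨ IsCongruence.≈⊆R Δc ( trans (π₁-app3 d _ _ _) (proj₂ (maltsev b a (θ.sym aθb)))
                                 , trans (π₂-app3 d _ _ _) (d-left b b)) ⟩
      u Δ.∎

lemma5p2 :
  ∀ {ℓ : Level} {S : Signature} (E : Equation S → Set) (d : Term S (Fin 3)) →
  IsWeakDiffTermOf E ℓ d →
  (A : Algebra S ℓ) → Mod E A →
  (θ : Rel (Car A) ℓ) (θc : IsCongruence A θ) → TC A θ θ (Eq A) →
  (α : Rel (Car A) ℓ) → IsAnnihilator A θ α →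
  (Δ : Rel (Car (Aθ A θ θc)) ℓ) (Δc : IsCongruence (Aθ A θ θc) Δ) →
  IsDelta A θ θc α Δ →
  -- (1) λ_e embeds 𝔸(θ,e) into 𝔻(φ,0_{e/α}), D = A(θ)/Δ, φ = ᾱ/Δ
  (∀ (e : Car A) →
    (∀ x (p : θ x e) → overline A θ θc α (lam A θ θc e x p) (zeroE A θ θc e)) ×
    (∀ x y (p : θ x e) (q : θ y e) (r : θ (app3 A d x e y) e) →
       Δ (lam A θ θc e (app3 A d x e y) r)
         (app3 (Quot (Aθ A θ θc) Δ Δc) d
            (lam A θ θc e x p) (zeroE A θ θc e) (lam A θ θc e y q))) ×
    (∀ x y (p : θ x e) (q : θ y e) →
       Δ (lam A θ θc e x p) (lam A θ θc e y q) → Eq A x y)) ×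
  -- (2) with a difference term, λ_e is moreover onto 𝔻(φ,0_{e/α})
  (Σ (Term S (Fin 3)) (IsDiffTermOf E ℓ) →
    ∀ (e : Car A) (u : Car (Aθ A θ θc)) →
      overline A θ θc α u (zeroE A θ θc e) →
      Σ[ x ∈ Car A ] Σ[ p ∈ θ x e ] Δ (lam A θ θc e x p) u)
lemma5p2 {ℓ} E d d-weak A A∈V θ θc θ-abelian α (αc , α-centralizes , α-largest) Δ Δc isΔ =
  (λ e → (λ x → θ⊆α)
       , (λ x y → lam-hom A θ θc Δc d (proj₁ (d-weak A A∈V)))
       , (λ x y → lam-injective A θ θc d α-sym α-centralizes isΔ (maltsev d d-weak)))
  , λ (d′ , d′-weak , d′-left) →
      lam-surjective A θ θc d′ α-equiv θ⊆α isΔ (maltsev d′ d′-weak) (d′-left A A∈V)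
  where
  α-equiv : IsEquivalence α
  α-equiv = IsCongruence.equiv αc

  α-sym : Symmetric α
  α-sym = IsEquivalence.sym α-equiv

  θ⊆α : ∀ {a b} → θ a b → α a b
  θ⊆α = α-largest θ θc θ-abelian _ _

  maltsev : ∀ d → IsWeakDiffTermOf E ℓ d → IsMaltsevOn A d θ
  maltsev d d-weak = weakDiffTerm-maltsevOnAbelian A d (d-weak A A∈V) θc θ-abelian
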